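{- Let $d\ge1$ and let $\maltese_d$ be the star graph with a central vertex of degree $d$ and $d$ petals of degree $1$. The number of components of any labeling of $\maltese_d$ lies between $0$ and $d$, and any labeling of $\maltese_d$ with exactly one component is equivalent to any labeling with $m$ components, for every odd $m\le d$.
   Context: Reeder's puzzle on a finite connected simple graph: a labeling assigns $a_i\in\mathbb{Z}/2\mathbb{Z}$ to each vertex $i$; the move $T_i$ replaces $a_i$ by $a_i+\sum_k a_k \pmod 2$ (sum over neighbors $k$ of $i$) and leaves other labels unchanged. Labelings are equivalent if related by a finite sequence of moves. Components of a labeling are the connected components of the subgraph induced on vertices labeled $1$. -}

module Defs where

open import Data.Nat using (ℕ; zero; suc)
open import Data.Fin using (Fin; zero; suc; _≟_)
open import Data.Bool using (Bool; true; false; _xor_; _∧_; if_then_else_)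
open import Data.List using (foldr)
open import Data.List using (List)
open import Data.Fin.Base using ()
open import Data.List.Base using (map)
open import Data.Product using (Σ; _×_; ∃)
open import Relation.Binary.PropositionalEquality using (_≡_)
open import Relation.Binary.Construct.Closure.ReflexiveTransitive using (Star)
open import Relation.Nullary using (does)
open import Function.Bundles using (_⇔_)
import Data.List as L

record Graph (n : ℕ) : Set where
  field
    adj   : Fin n → Fin n → Bool
    sym   : ∀ i j → adj i j ≡ adj j i
    irrefl : ∀ i → adj i i ≡ false
open Graph public

-- Labelings with values in Z/2Z, encoded as Bool (false = 0, true = 1, xor = +).
Labeling : ℕ → Set
Labeling n = Fin n → Bool

neighbourSum : ∀ {n} → Graph n → Labeling n → Fin n → Bool
neighbourSum {n} G a i = foldr (λ k s → (adj G i k ∧ a k) xor s) false (L.allFin n)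

move : ∀ {n} → Graph n → Fin n → Labeling n → Labeling n
move G i a j = if does (j ≟ i) then a i xor neighbourSum G a i else a j

Step : ∀ {n} → Graph n → Labeling n → Labeling n → Set
Step G a b = ∃ λ i → ∀ j → b j ≡ move G i a j

Equivalent : ∀ {n} → Graph n → Labeling n → Labeling n → Set
Equivalent G = Star (Step G)

InducedEdge : ∀ {n} → Graph n → Labeling n → Fin n → Fin n → Set
InducedEdge G a u v = (a u ≡ true) × (a v ≡ true) × (adj G u v ≡ true)

Connected : ∀ {n} → Graph n → Labeling n → Fin n → Fin n → Set
Connected G a = Star (InducedEdge G a)

-- "The labeling a has exactly k components": there is a surjective
-- assignment of the 1-labelled vertices to Fin k whose fibres are exactly
-- the connected components of the induced subgraph on 1-labelled vertices.
HasComponents : ∀ {n} → Graph n → Labeling n → ℕ → Set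
HasComponents {n} G a k =
  Σ ((v : Fin n) → a v ≡ true → Fin k) λ c →
    (∀ (j : Fin k) → ∃ λ v → Σ (a v ≡ true) λ p → c v p ≡ j) ×
    (∀ u (p : a u ≡ true) v (q : a v ≡ true) → (c u p ≡ c v q) ⇔ Connected G a u v)

-- The star graph ✠_d : vertex 0 is the centre, vertices 1..d are the petals.
starAdj : ∀ {d} → Fin (suc d) → Fin (suc d) → Bool
starAdj zero    zero    = false
starAdj zero    (suc _) = true
starAdj (suc _) zero    = true
starAdj (suc _) (suc _) = false

starSym : ∀ {d} (i j : Fin (suc d)) → starAdj i j ≡ starAdj j i
starSym zero    zero    = _≡_.refl
starSym zero    (suc _) = _≡_.refl
starSym (suc _) zero    = _≡_.refl
starSym (suc _) (suc _) = _≡_.refl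

starIrrefl : ∀ {d} (i : Fin (suc d)) → starAdj i i ≡ false
starIrrefl zero    = _≡_.refl
starIrrefl (suc _) = _≡_.refl

Star-graph : (d : ℕ) → Graph (suc d)
Star-graph d = record { adj = starAdj ; sym = starSym ; irrefl = starIrrefl }

module Submission where

open import Defs
open import Data.Nat using (ℕ; suc; _≤_; _%_)
open import Relation.Binary.PropositionalEquality using (_≡_)
open import Data.Product using (_×_; ∃)

open import Axiom.UniquenessOfIdentityProofs using (module Decidable⇒UIP)
open import Data.Bool using (Bool; true; false; not; _∧_; _∨_; _xor_; if_then_else_)
open import Data.Bool.Properties
  using (¬-not; true-xor; xor-comm; xor-assoc; xor-same; xor-identityʳ)
  renaming (_≟_ to _≟ᵇ_)
open import Data.Empty using (⊥-elim)
open import Data.Fin using (Fin; zero; suc; _≟_)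
open import Data.Fin.Properties using (suc-injective; injective⇒≤)
open import Data.List using ([]; _∷_; foldr; tabulate; allFin)
open import Data.List.Membership.Propositional using (_∈_)
open import Data.List.Membership.Propositional.Properties using (∈-allFin)
open import Data.List.Properties using (foldr-cong)
open import Data.List.Relation.Unary.Any using (here; there)
open import Data.Nat using (zero; z≤n; s≤s)
open import Data.Nat.DivMod using (%-distribˡ-+)
open import Data.Nat.Properties using (≤-trans; ≤-antisym; m≤n⇒m≤1+n)
open import Data.Product using (Σ; _,_)
open import Data.Sum using (_⊎_; inj₁; inj₂)
import Data.Vec.Functional as Vector
open import Data.Vec.Functional using (tail)
open import Function using (_∘_)
open import Function.Bundles using (mk⇔; Equivalence)
open import Relation.Binary.Construct.Closure.ReflexiveTransitive using (ε; _◅_; _◅◅_; reverse)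
open import Relation.Binary.Definitions using (Sym)
open import Relation.Binary.PropositionalEquality
  using (refl; trans; cong; cong₂; subst; _≢_; _≗_; module ≡-Reasoning)
import Relation.Binary.PropositionalEquality as ≡
open import Relation.Nullary using (¬_; does; yes; no)

-- In the star, a move at a petal flips that petal exactly when the centre
-- is 1, and a move at the centre adds the parity of the petals to it. So
-- all labelings with centre 1 are equivalent, and a labeling with centre 0
-- reaches one of them iff its petals have odd parity. With centre 1 a
-- labeling has one component; with centre 0 its components are the petals
-- labelled 1, whose number has the parity of the petals.

xorAll : ∀ {n} → (Fin n → Bool) → Bool
xorAll = Vector.foldr _xor_ false

countTrue : ∀ {n} → (Fin n → Bool) → ℕ
countTrue = Vector.foldr (λ b k → if b then suc k else k) 0

countTrue-≤ : ∀ {n} (P : Fin n → Bool) → countTrue P ≤ n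
countTrue-≤ {zero}  P = z≤n
countTrue-≤ {suc n} P with P zero
... | true  = s≤s (countTrue-≤ (tail P))
... | false = m≤n⇒m≤1+n (countTrue-≤ (tail P))

countTrue-mod-2 : ∀ {n} (P : Fin n → Bool) → countTrue P % 2 ≡ (if xorAll P then 1 else 0)
countTrue-mod-2 {zero}  P = refl
countTrue-mod-2 {suc n} P with P zero
... | false = countTrue-mod-2 (tail P)
... | true  = suc-mod-2 (countTrue (tail P)) (xorAll (tail P)) (countTrue-mod-2 (tail P))
  where
  suc-mod-2 : ∀ m b → m % 2 ≡ (if b then 1 else 0) → suc m % 2 ≡ (if not b then 1 else 0)
  suc-mod-2 m true  e = trans (%-distribˡ-+ 1 m 2) (cong (λ r → suc r % 2) e)
  suc-mod-2 m false e = trans (%-distribˡ-+ 1 m 2) (cong (λ r → suc r % 2) e)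

odd-countTrue⇒xorAll : ∀ {n} (P : Fin n → Bool) → countTrue P % 2 ≡ 1 → xorAll P ≡ true
odd-countTrue⇒xorAll P odd with xorAll P | countTrue-mod-2 P
... | true  | _    = refl
... | false | even with () ← trans (≡.sym even) odd

record Enumeration {n} (P : Fin n → Bool) (k : ℕ) : Set where
  field
    index            : ∀ v → P v ≡ true → Fin k
    index-surjective : ∀ j → ∃ λ v → Σ (P v ≡ true) λ p → index v p ≡ j
    index-injective  : ∀ u p v q → index u p ≡ index v q → u ≡ v

enumeration-[] : (P : Fin 0 → Bool) → Enumeration P 0
enumeration-[] P = record { index = λ () ; index-surjective = λ () ; index-injective = λ () }

module _ {n k} {P : Fin (suc n) → Bool} (E : Enumeration (tail P) k) where
  private module E = Enumeration E

  enumeration-true∷ : P zero ≡ true → Enumeration P (suc k)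
  enumeration-true∷ P₀ = record
    { index = index ; index-surjective = surjective ; index-injective = injective }
    where
    index : ∀ v → P v ≡ true → Fin (suc k)
    index zero    _ = zero
    index (suc v) p = suc (E.index v p)

    surjective : ∀ j → ∃ λ v → Σ (P v ≡ true) λ p → index v p ≡ j
    surjective zero    = zero , P₀ , refl
    surjective (suc j) with E.index-surjective j
    ... | v , p , e = suc v , p , cong suc e

    injective : ∀ u p v q → index u p ≡ index v q → u ≡ v
    injective zero    _ zero    _ _ = refl
    injective (suc u) p (suc v) q e = cong suc (E.index-injective u p v q (suc-injective e))

  enumeration-false∷ : P zero ≡ false → Enumeration P k
  enumeration-false∷ P₀ = record
    { index = index ; index-surjective = surjective ; index-injective = injective }
    where
    index : ∀ v → P v ≡ true → Fin k
    index zero    p with () ← trans (≡.sym P₀) p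
    index (suc v) p = E.index v p

    surjective : ∀ j → ∃ λ v → Σ (P v ≡ true) λ p → index v p ≡ j
    surjective j with E.index-surjective j
    ... | v , p , e = suc v , p , e

    injective : ∀ u p v q → index u p ≡ index v q → u ≡ v
    injective zero    p _       _ _ with () ← trans (≡.sym P₀) p
    injective (suc u) _ zero    q _ with () ← trans (≡.sym P₀) q
    injective (suc u) p (suc v) q e = cong suc (E.index-injective u p v q e)

enumeration : ∀ {n} (P : Fin n → Bool) → Enumeration P (countTrue P)
enumeration {zero}  P = enumeration-[] P
enumeration {suc n} P with P zero in P₀
... | true  = enumeration-true∷  (enumeration (tail P)) P₀
... | false = enumeration-false∷ (enumeration (tail P)) P₀

-- Chosen so that move G i a is definitionally a [ i ]≔ (a i xor neighbourSum G a i).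
_[_]≔_ : ∀ {n} → Labeling n → Fin n → Bool → Labeling n
(a [ i ]≔ b) j = if does (j ≟ i) then b else a j

module _ {n} (a : Labeling n) (i : Fin n) where

  []≔-updates : ∀ b → (a [ i ]≔ b) i ≡ b
  []≔-updates b with i ≟ i
  ... | yes _   = refl
  ... | no  i≢i = ⊥-elim (i≢i refl)

  []≔-minimal : ∀ {j} b → j ≢ i → (a [ i ]≔ b) j ≡ a j
  []≔-minimal {j} b j≢i with j ≟ i
  ... | yes j≡i = ⊥-elim (j≢i j≡i)
  ... | no  _   = refl

  []≔-lookup : a ≗ a [ i ]≔ a i
  []≔-lookup j with j ≟ i
  ... | yes refl = refl
  ... | no  _    = refl

module _ {n} (G : Graph n) where

  adjacent⇒≢ : ∀ {i k} → adj G i k ≡ true → k ≢ i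
  adjacent⇒≢ {i} i~k refl with () ← trans (≡.sym i~k) (irrefl G i)

  neighbourSum-local : ∀ {a b} i → (∀ k → adj G i k ≡ true → a k ≡ b k) →
                       neighbourSum G a i ≡ neighbourSum G b i
  neighbourSum-local {a} {b} i agree =
    foldr-cong (λ k s → cong (_xor s) (weight k)) refl (allFin n)
    where
    weight : ∀ k → adj G i k ∧ a k ≡ adj G i k ∧ b k
    weight k with adj G i k in i~k
    ... | true  = agree k i~k
    ... | false = refl

  neighbourSum-move : ∀ a i → neighbourSum G (move G i a) i ≡ neighbourSum G a i
  neighbourSum-move a i = neighbourSum-local i λ k i~k → []≔-minimal a i _ (adjacent⇒≢ i~k)

  move-involutive : ∀ a i → move G i (move G i a) ≗ a
  move-involutive a i j with j ≟ i
  ... | no  _    = refl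
  ... | yes refl = begin
    move G i a i xor neighbourSum G (move G i a) i
      ≡⟨ cong₂ _xor_ ([]≔-updates a i _) (neighbourSum-move a i) ⟩
    (a i xor s) xor s                              ≡⟨ xor-assoc (a i) s s ⟩
    a i xor (s xor s)                              ≡⟨ cong (a i xor_) (xor-same s) ⟩
    a i xor false                                  ≡⟨ xor-identityʳ (a i) ⟩
    a i                                            ∎
    where
    open ≡-Reasoning
    s : Bool
    s = neighbourSum G a i

  move-cong : ∀ {a b} i → a ≗ b → move G i a ≗ move G i b
  move-cong i a≗b j with j ≟ i
  ... | yes _ = cong₂ _xor_ (a≗b i) (neighbourSum-local i λ k _ → a≗b k)
  ... | no  _ = a≗b j

  Step-sym : Sym (Step G) (Step G)
  Step-sym {a} (i , b≗) = i , λ j → ≡.sym (trans (move-cong i b≗ j) (move-involutive a i j))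

  Equivalent-sym : Sym (Equivalent G) (Equivalent G)
  Equivalent-sym = reverse Step-sym

  -- A move followed by its inverse; any vertex will do.
  ≗⇒Equivalent : ∀ {a b} → Fin n → a ≗ b → Equivalent G a b
  ≗⇒Equivalent {a} i a≗b =
    (i , λ _ → refl) ◅ (i , λ j → ≡.sym (trans (move-involutive a i j) (a≗b j))) ◅ ε

  Connected-sym : ∀ {a} → Sym (Connected G a) (Connected G a)
  Connected-sym = reverse λ (au , av , u~v) → av , au , trans (sym G _ _) u~v

module _ {n} (G : Graph n) (a : Labeling n) where

  components-≤ : ∀ {k l} → HasComponents G a k → HasComponents G a l → k ≤ l
  components-≤ {k} {l} (c , c-surjective , c-components) (c′ , _ , c′-components) =
    injective⇒≤ reindex-injective
    where
    reindex : Fin k → Fin l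
    reindex j with c-surjective j
    ... | v , p , _ = c′ v p

    reindex-injective : ∀ {j j′} → reindex j ≡ reindex j′ → j ≡ j′
    reindex-injective {j} {j′} e with c-surjective j | c-surjective j′
    ... | v , p , refl | v′ , p′ , refl =
      Equivalence.from (c-components v p v′ p′) (Equivalence.to (c′-components v p v′ p′) e)

  components-unique : ∀ {k l} → HasComponents G a k → HasComponents G a l → k ≡ l
  components-unique hk hl = ≤-antisym (components-≤ hk hl) (components-≤ hl hk)

  edgeless-components : ∀ {k} → (∀ {u v} → Connected G a u v → u ≡ v) →
                        Enumeration a k → HasComponents G a k
  edgeless-components edgeless E =
    index , index-surjective ,
    λ u p v q → mk⇔ (λ e → subst (Connected G a u) (index-injective u p v q e) ε)
                    (λ u⋯v → index-cong (edgeless u⋯v))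
    where
    open Enumeration E
    index-cong : ∀ {u v p q} → u ≡ v → index u p ≡ index v q
    index-cong {u} {p = p} {q} refl = cong (index u) (Decidable⇒UIP.≡-irrelevant _≟ᵇ_ p q)

  rooted-components : ∀ r → a r ≡ true → (∀ v → a v ≡ true → Connected G a v r) →
                      HasComponents G a 1
  rooted-components r ar toRoot =
    (λ _ _ → zero) , (λ { zero → r , ar , refl }) ,
    λ u p v q → mk⇔ (λ _ → toRoot u p ◅◅ Connected-sym G (toRoot v q)) (λ _ → refl)

module _ (d : ℕ) where

  ✠ : Graph (suc d)
  ✠ = Star-graph d

  centre-neighbourSum : ∀ a → neighbourSum ✠ a zero ≡ xorAll (tail a)
  centre-neighbourSum a = petals (λ i → i)
    where
    petals : ∀ {m} (g : Fin m → Fin d) →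
             foldr (λ k s → (starAdj zero k ∧ a k) xor s) false (tabulate (suc ∘ g))
             ≡ xorAll (a ∘ suc ∘ g)
    petals {zero}  g = refl
    petals {suc m} g = cong (a (suc (g zero)) xor_) (petals (g ∘ suc))

  petal-neighbourSum : ∀ a p → neighbourSum ✠ a (suc p) ≡ a zero
  petal-neighbourSum a p = trans (cong (a zero xor_) (others (λ i → i))) (xor-identityʳ (a zero))
    where
    others : ∀ {m} (g : Fin m → Fin d) →
             foldr (λ k s → (starAdj (suc p) k ∧ a k) xor s) false (tabulate (suc ∘ g))
             ≡ false
    others {zero}  g = refl
    others {suc m} g = others (g ∘ suc)

  centreOn-components : ∀ {a} → a zero ≡ true → HasComponents ✠ a 1
  centreOn-components {a} a₀ = rooted-components ✠ a zero a₀ toCentre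
    where
    toCentre : ∀ v → a v ≡ true → Connected ✠ a v zero
    toCentre zero    _ = ε
    toCentre (suc _) p = (p , a₀ , refl) ◅ ε

  centreOff-components : ∀ {a} → a zero ≡ false → HasComponents ✠ a (countTrue (tail a))
  centreOff-components {a} a₀ =
    edgeless-components ✠ a edgeless (enumeration-false∷ (enumeration (tail a)) a₀)
    where
    noEdge : ∀ {u w} → ¬ InducedEdge ✠ a u w
    noEdge {zero}          (au , _ , _) with () ← trans (≡.sym a₀) au
    noEdge {suc _} {zero}  (_ , aw , _) with () ← trans (≡.sym a₀) aw
    noEdge {suc _} {suc _} (_ , _ , ())

    edgeless : ∀ {u v} → Connected ✠ a u v → u ≡ v
    edgeless ε       = refl
    edgeless (e ◅ _) = ⊥-elim (noEdge e)

  star-components : 1 ≤ d → ∀ a → ∃ λ k → HasComponents ✠ a k × k ≤ d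
  star-components 1≤d a with a zero in a₀
  ... | true  = 1 , centreOn-components a₀ , 1≤d
  ... | false = countTrue (tail a) , centreOff-components a₀ , countTrue-≤ (tail a)

  odd-components⇒centreOn∨oddPetals : ∀ {a m} → HasComponents ✠ a m → m % 2 ≡ 1 →
                                       a zero ∨ xorAll (tail a) ≡ true
  odd-components⇒centreOn∨oddPetals {a} {m} hm odd with a zero in a₀
  ... | true  = refl
  ... | false = odd-countTrue⇒xorAll (tail a) (subst (λ k → k % 2 ≡ 1) m≡count odd)
    where
    m≡count : m ≡ countTrue (tail a)
    m≡count = components-unique ✠ a hm (centreOff-components a₀)

  centreOn-reachable : ∀ a → a zero ∨ xorAll (tail a) ≡ true →
                       ∃ λ x → x zero ≡ true × Equivalent ✠ a x
  centreOn-reachable a h with a zero in a₀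
  ... | true  = a , a₀ , ε
  ... | false = move ✠ zero a , centre-lit , (zero , λ _ → refl) ◅ ε
    where
    centre-lit : move ✠ zero a zero ≡ true
    centre-lit = trans ([]≔-updates a zero _) (trans (cong₂ _xor_ a₀ (centre-neighbourSum a)) h)

  petal-set : ∀ {x} → x zero ≡ true → ∀ p b → Equivalent ✠ x (x [ suc p ]≔ b)
  petal-set {x} x₀ p b with b ≟ᵇ x (suc p)
  ... | yes refl = ≗⇒Equivalent ✠ zero ([]≔-lookup x (suc p))
  ... | no  b≢x  = (suc p , λ j → cong (λ c → (x [ suc p ]≔ c) j) flipped) ◅ ε
    where
    open ≡-Reasoning
    flipped : b ≡ x (suc p) xor neighbourSum ✠ x (suc p)
    flipped = begin
      b                                 ≡⟨ ¬-not b≢x ⟩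
      not (x (suc p))                   ≡⟨ ≡.sym (true-xor _) ⟩
      true xor x (suc p)                ≡⟨ xor-comm true _ ⟩
      x (suc p) xor true
        ≡⟨ cong (x (suc p) xor_) (≡.sym (trans (petal-neighbourSum x p) x₀)) ⟩
      x (suc p) xor neighbourSum ✠ x (suc p) ∎

  centreOn-equivalent : ∀ {x y} → x zero ≡ true → y zero ≡ true → Equivalent ✠ x y
  centreOn-equivalent {y = y} x₀ y₀ = fix (allFin d) x₀ (λ p → inj₁ (∈-allFin p))
    where
    fix : ∀ ps {x} → x zero ≡ true → (∀ p → p ∈ ps ⊎ x (suc p) ≡ y (suc p)) →
          Equivalent ✠ x y
    fix [] {x} x₀ agree = ≗⇒Equivalent ✠ zero x≗y
      where
      x≗y : x ≗ y
      x≗y zero    = trans x₀ (≡.sym y₀)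
      x≗y (suc p) with agree p
      ... | inj₂ e = e
    fix (p ∷ ps) {x} x₀ agree = petal-set x₀ p (y (suc p)) ◅◅ fix ps x₀ agree′
      where
      agree′ : ∀ q → q ∈ ps ⊎ (x [ suc p ]≔ y (suc p)) (suc q) ≡ y (suc q)
      agree′ q with q ≟ p
      ... | yes refl = inj₂ refl
      ... | no  q≢p with agree q
      ...   | inj₁ (here q≡p) = ⊥-elim (q≢p q≡p)
      ...   | inj₁ (there q∈ps) = inj₁ q∈ps
      ...   | inj₂ e = inj₂ e

proposition3p13 : (d : ℕ) → 1 ≤ d →
    ((a : Labeling (suc d)) →
      (∃ λ k → HasComponents (Star-graph d) a k) ×
      (∀ k → HasComponents (Star-graph d) a k → k ≤ d)) ×
    (∀ (a b : Labeling (suc d)) (m : ℕ) → m % 2 ≡ 1 → m ≤ d →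
      HasComponents (Star-graph d) a 1 → HasComponents (Star-graph d) b m →
      Equivalent (Star-graph d) a b)
proposition3p13 d 1≤d = bounded , connected
  where
  bounded : (a : Labeling (suc d)) →
            (∃ λ k → HasComponents (✠ d) a k) × (∀ k → HasComponents (✠ d) a k → k ≤ d)
  bounded a with star-components d 1≤d a
  ... | k , hk , k≤d = (k , hk) , λ l hl → ≤-trans (components-≤ (✠ d) a hl hk) k≤d

  connected : ∀ a b m → m % 2 ≡ 1 → m ≤ d →
              HasComponents (✠ d) a 1 → HasComponents (✠ d) b m →
              Equivalent (✠ d) a b
  connected a b m odd _ ha hb
    with centreOn-reachable d a (odd-components⇒centreOn∨oddPetals d ha refl)
       | centreOn-reachable d b (odd-components⇒centreOn∨oddPetals d hb odd)
  ... | x , x₀ , a~x | y , y₀ , b~y =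
    a~x ◅◅ centreOn-equivalent d x₀ y₀ ◅◅ Equivalent-sym (✠ d) b~y
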